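{- For all $\mathcal{L}$-frames $\mathbb{F}_1$ and $\mathbb{F}_2$, 1. $(S, T) = (S_{h_{(S,T)}}, T_{h_{(S,T)}})$ for every p-morphism $(S,T):\mathbb{F}_1\to\mathbb{F}_2$. 2. $h = h_{(S_h,T_h)}$ for every complete $\mathcal{L}$-homomorphism $h:(\mathbb{F}_1)^+\to(\mathbb{F}_2)^+$.
   Context: Setting: $\mathcal{L}$-frames $\mathbb{F}_k=(W_k,U_k,N_k,\{R^k_f\},\{R^k_g\})$ with polarity maps $X^\uparrow=\{u\mid\forall w\in X\,wNu\}$, $Y^\downarrow=\{w\mid\forall u\in Y\,wNu\}$; complex algebras $\mathbb{F}_k^+$ consist of concepts $a=([\![a]\!],(\![a]\!))$ (extension $[\![a]\!]\subseteq W_k$, intension $(\![a]\!)\subseteq U_k$, $(\![a]\!)=[\![a]\!]^\uparrow$, $[\![a]\!]=(\![a]\!)^\downarrow$) with operations induced by the relations $R_f,R_g$. A p-morphism $(S,T):\mathbb{F}_1\to\mathbb{F}_2$ is a pair $S\subseteq W_1\times U_2$, $T\subseteq U_1\times W_2$ such that: $S^{(0)}[u]$, $S^{(1)}[w]$, $T^{(0)}[w]$, $T^{(1)}[u]$ are Galois stable; $(T^{(0)}[w])^\downarrow\subseteq S^{(0)}[w^\uparrow]$ for $w\in W_2$; $T^{(0)}[(S^{(1)}[w])^\downarrow]\subseteq w^\uparrow$ for $w\in W_1$; $T^{(0)}[((R^2_f)^{(0)}[\overline{w}])^\downarrow]=(R^1_f)^{(0)}[\overline{Z}]$ with $Z_i=(T^{(0)}[w_i])^\downarrow$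 if $\epsilon_f(i)=1$, $(S^{(0)}[w_i])^\uparrow$ if $\epsilon_f(i)=\partial$; $S^{(0)}[((R^2_g)^{(0)}[\overline{u}])^\uparrow]=(R^1_g)^{(0)}[\overline{Z}]$ with $Z_i=(S^{(0)}[u_i])^\uparrow$ if $\epsilon_g(i)=1$, $(T^{(0)}[u_i])^\downarrow$ if $\epsilon_g(i)=\partial$. Here $S^{(0)}[Y]=\{w\mid\forall u\in Y\,wSu\}$, $S^{(1)}[X]=\{u\mid\forall w\in X\,wSu\}$, and likewise for $T$. For a p-morphism $(S,T):\mathbb{F}_1\to\mathbb{F}_2$, $h_{(S,T)}:\mathbb{F}_2^+\to\mathbb{F}_1^+$ is $h(a)=(S^{(0)}[(\![a]\!)],T^{(0)}[[\![a]\!]])$, a complete $\mathcal{L}$-homomorphism. For a complete $\mathcal{L}$-homomorphism $h:\mathbb{F}_1^+\to\mathbb{F}_2^+$, $(S_h,T_h):\mathbb{F}_2\to\mathbb{F}_1$ is defined by $S_h(w,u)$ iff $w\in[\![h(u^{\downarrow\uparrow})]\!]$ and $T_h(u,w)$ iff $u\in(\![h(w^{\uparrow\downarrow})]\!)$, where $u^{\downarrow\uparrow}$ is the concept $(\{u\}^\downarrow,\{u\}^{\downarrow\uparrow})$ and $w^{\uparrow\downarrow}$ the concept $(\{w\}^{\uparrow\downarrow},\{w\}^\uparrow)$; it is a p-morphism. -}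

module Defs where

open import Level using (0ℓ)
open import Data.Nat using (ℕ)
open import Data.Fin using (Fin; _≟_)
open import Data.Product using (_×_; _,_; proj₁; proj₂)
open import Relation.Nullary using (yes; no)
open import Relation.Unary using (Pred; _⊆_; _≐_; ｛_｝)
open import Relation.Binary.PropositionalEquality using (_≡_; refl)

data OrderType : Set where
  one  : OrderType
  dual : OrderType

record Signature : Set₁ where
  field
    FOp  : Set
    GOp  : Set
    arF  : FOp → ℕ
    arG  : GOp → ℕ
    εF   : (f : FOp) → Fin (arF f) → OrderType
    εG   : (g : GOp) → Fin (arG g) → OrderType
open Signature public

up : {W U : Set} → (W → U → Set) → Pred W 0ℓ → Pred U 0ℓ
up N X u = ∀ w → X w → N w u

down : {W U : Set} → (W → U → Set) → Pred U 0ℓ → Pred W 0ℓ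
down N Y w = ∀ u → Y u → N w u

StableW : {W U : Set} → (W → U → Set) → Pred W 0ℓ → Set
StableW N X = X ≐ down N (up N X)

StableU : {W U : Set} → (W → U → Set) → Pred U 0ℓ → Set
StableU N Y = Y ≐ up N (down N Y)

-- Coordinate domains: R_f ⊆ U × W^{ε_f},  R_g ⊆ W × U^{ε_g}
-- (W^1 = W, W^∂ = U ;  U^1 = U, U^∂ = W)
DomF : Set → Set → OrderType → Set
DomF W U one  = W
DomF W U dual = U

DomG : Set → Set → OrderType → Set
DomG W U one  = U
DomG W U dual = W

StableDomF : {W U : Set} → (W → U → Set) → (e : OrderType) → Pred (DomF W U e) 0ℓ → Set
StableDomF N one  X = StableW N X
StableDomF N dual Y = StableU N Y

StableDomG : {W U : Set} → (W → U → Set) → (e : OrderType) → Pred (DomG W U e) 0ℓ → Set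
StableDomG N one  Y = StableU N Y
StableDomG N dual X = StableW N X

upd : {n : ℕ} {D : Fin n → Set} → ((j : Fin n) → D j) → (i : Fin n) → D i → (j : Fin n) → D j
upd v i x j with i ≟ j
... | yes refl = x
... | no _     = v j

R0 : {A : Set} {n : ℕ} {D : Fin n → Set} →
     (A → ((i : Fin n) → D i) → Set) → ((i : Fin n) → Pred (D i) 0ℓ) → Pred A 0ℓ
R0 R Z a = ∀ z → (∀ i → Z i (z i)) → R a z

rel0 : {A B : Set} → (A → B → Set) → Pred B 0ℓ → Pred A 0ℓ
rel0 R Y a = ∀ b → Y b → R a b

rel1 : {A B : Set} → (A → B → Set) → Pred A 0ℓ → Pred B 0ℓ
rel1 R X b = ∀ a → X a → R a b

record Frame (L : Signature) : Set₁ where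
  field
    W  : Set
    U  : Set
    N  : W → U → Set
    Rf : (f : FOp L) → U → ((i : Fin (arF L f)) → DomF W U (εF L f i)) → Set
    Rg : (g : GOp L) → W → ((i : Fin (arG L g)) → DomG W U (εG L g i)) → Set
    compatF0 : (f : FOp L) (ws : (i : Fin (arF L f)) → DomF W U (εF L f i)) →
               StableU N (λ u → Rf f u ws)
    compatFi : (f : FOp L) (i : Fin (arF L f)) (u : U)
               (ws : (j : Fin (arF L f)) → DomF W U (εF L f j)) →
               StableDomF N (εF L f i)
                 (λ x → Rf f u (upd {D = λ j → DomF W U (εF L f j)} ws i x))
    compatG0 : (g : GOp L) (us : (i : Fin (arG L g)) → DomG W U (εG L g i)) →
               StableW N (λ w → Rg g w us)
    compatGi : (g : GOp L) (i : Fin (arG L g)) (w : W)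
               (us : (j : Fin (arG L g)) → DomG W U (εG L g j)) →
               StableDomG N (εG L g i)
                 (λ x → Rg g w (upd {D = λ j → DomG W U (εG L g j)} us i x))
open Frame public

module _ {L : Signature} (F : Frame L) where

  record Concept : Set₁ where
    field
      ext      : Pred (W F) 0ℓ
      int      : Pred (U F) 0ℓ
      int-up   : int ≐ up (N F) ext
      ext-down : ext ≐ down (N F) int
  open Concept public

  _≈_ : Concept → Concept → Set
  a ≈ b = (ext a ≐ ext b) × (int a ≐ int b)

  mkInt : Pred (U F) 0ℓ → Concept
  mkInt Y = record
    { ext = down (N F) Y
    ; int = up (N F) (down (N F) Y)
    ; int-up = (λ p → p) , (λ p → p)
    ; ext-down = (λ {w} p u q → q w p) , (λ {w} p u y → p u (λ w' q → q u y)) }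

  mkExt : Pred (W F) 0ℓ → Concept
  mkExt X = record
    { ext = down (N F) (up (N F) X)
    ; int = up (N F) X
    ; int-up = (λ {u} p w q → q u p) , (λ {u} p w x → p w (λ u' q → q w x))
    ; ext-down = (λ p → p) , (λ p → p) }

  ⋀ : {I : Set} → (I → Concept) → Concept
  ⋀ a = mkExt (λ w → ∀ i → ext (a i) w)

  ⋁ : {I : Set} → (I → Concept) → Concept
  ⋁ a = mkInt (λ u → ∀ i → int (a i) u)

  argF : (e : OrderType) → Concept → Pred (DomF (W F) (U F) e) 0ℓ
  argF one  a = ext a
  argF dual a = int a

  argG : (e : OrderType) → Concept → Pred (DomG (W F) (U F) e) 0ℓ
  argG one  a = int a
  argG dual a = ext a

  fPlus : (f : FOp L) → (Fin (arF L f) → Concept) → Concept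
  fPlus f as = mkInt (R0 (Rf F f) (λ i → argF (εF L f i) (as i)))

  gPlus : (g : GOp L) → (Fin (arG L g) → Concept) → Concept
  gPlus g as = mkExt (R0 (Rg F g) (λ i → argG (εG L g i) (as i)))

  PreConcept : Set₁
  PreConcept = Pred (W F) 0ℓ × Pred (U F) 0ℓ

  toPre : Concept → PreConcept
  toPre a = ext a , int a

record IsCompleteHom {L : Signature} (F₁ F₂ : Frame L) (h : Concept F₁ → Concept F₂) : Set₁ where
  field
    cong  : ∀ a b → _≈_ F₁ a b → _≈_ F₂ (h a) (h b)
    pres-⋀ : (I : Set) (a : I → Concept F₁) → _≈_ F₂ (h (⋀ F₁ a)) (⋀ F₂ (λ i → h (a i)))
    pres-⋁ : (I : Set) (a : I → Concept F₁) → _≈_ F₂ (h (⋁ F₁ a)) (⋁ F₂ (λ i → h (a i)))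
    pres-f : (f : FOp L) (as : Fin (arF L f) → Concept F₁) →
             _≈_ F₂ (h (fPlus F₁ f as)) (fPlus F₂ f (λ i → h (as i)))
    pres-g : (g : GOp L) (as : Fin (arG L g) → Concept F₁) →
             _≈_ F₂ (h (gPlus F₁ g as)) (gPlus F₂ g (λ i → h (as i)))

module _ {L : Signature} (F₁ F₂ : Frame L)
         (S : W F₁ → U F₂ → Set) (T : U F₁ → W F₂ → Set) where

  Zf : (e : OrderType) → DomF (W F₂) (U F₂) e → Pred (DomF (W F₁) (U F₁) e) 0ℓ
  Zf one  w = down (N F₁) (rel0 T ｛ w ｝)
  Zf dual u = up (N F₁) (rel0 S ｛ u ｝)

  Zg : (e : OrderType) → DomG (W F₂) (U F₂) e → Pred (DomG (W F₁) (U F₁) e) 0ℓ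
  Zg one  u = up (N F₁) (rel0 S ｛ u ｝)
  Zg dual w = down (N F₁) (rel0 T ｛ w ｝)

  record IsPMorphism : Set₁ where
    field
      stS0 : (u : U F₂) → StableW (N F₁) (rel0 S ｛ u ｝)
      stS1 : (w : W F₁) → StableU (N F₂) (rel1 S ｛ w ｝)
      stT0 : (w : W F₂) → StableU (N F₁) (rel0 T ｛ w ｝)
      stT1 : (u : U F₁) → StableW (N F₂) (rel1 T ｛ u ｝)
      back : (w : W F₂) → down (N F₁) (rel0 T ｛ w ｝) ⊆ rel0 S (up (N F₂) ｛ w ｝)
      forth : (w : W F₁) → rel0 T (down (N F₂) (rel1 S ｛ w ｝)) ⊆ up (N F₁) ｛ w ｝
      presF : (f : FOp L) (ws : (i : Fin (arF L f)) → DomF (W F₂) (U F₂) (εF L f i)) →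
              rel0 T (down (N F₂) (λ u → Rf F₂ f u ws))
                ≐ R0 (Rf F₁ f) (λ i → Zf (εF L f i) (ws i))
      presG : (g : GOp L) (us : (i : Fin (arG L g)) → DomG (W F₂) (U F₂) (εG L g i)) →
              rel0 S (up (N F₂) (λ w → Rg F₂ g w us))
                ≐ R0 (Rg F₁ g) (λ i → Zg (εG L g i) (us i))

  hST : Concept F₂ → PreConcept F₁
  hST a = rel0 S (int a) , rel0 T (ext a)

module _ {L : Signature} (FA FB : Frame L) (h : Concept FA → PreConcept FB) where

  Sh : W FB → U FA → Set
  Sh w u = proj₁ (h (mkInt FA ｛ u ｝)) w

  Th : U FB → W FA → Set
  Th u w = proj₂ (h (mkExt FA ｛ w ｝)) u

_≡ᴿ_ : {A B : Set} → (A → B → Set) → (A → B → Set) → Set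
R ≡ᴿ R' = ∀ a b → (R a b → R' a b) × (R' a b → R a b)

-- A concept is the meet of the concepts generated by the elements of its intension
-- and the join of those generated by the elements of its extension.  A complete
-- homomorphism h therefore sends a to the intersection of the extents of the
-- h(u↓↑), u ∈ (a), and to the intersection of the intents of the h(w↑↓), w ∈ [a]:
-- this is h_{(S_h,T_h)}(a).  Conversely S_{h_{(S,T)}}(w,u) says {u}↓↑ ⊆ S^{(1)}[w],
-- which is S(w,u) because S^{(1)}[w] is Galois stable; likewise for T.
module Submission where

open import Defs
open import Data.Product using (Σ; _×_; _,_; proj₁; proj₂)
open import Function using (_∘_; flip)
open import Relation.Binary.PropositionalEquality using (refl)
open import Relation.Unary using (Pred; _⊆_; _≐_; ｛_｝)
open import Relation.Unary.Properties using (≐-trans)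
open import Level using (0ℓ)

module Polarity {W U : Set} (N : W → U → Set) where

  ⊆-down-up : {X : Pred W 0ℓ} → X ⊆ down N (up N X)
  ⊆-down-up x u xN = xN _ x

  up-antitone : {X Z : Pred W 0ℓ} → X ⊆ Z → up N Z ⊆ up N X
  up-antitone X⊆Z zN w x = zN w (X⊆Z x)

  down-up-least : {X Z : Pred W 0ℓ} → StableW N Z → X ⊆ Z → down N (up N X) ⊆ Z
  down-up-least Z-stable X⊆Z w↑↓ = proj₂ Z-stable (λ u z↑ → w↑↓ u (up-antitone X⊆Z z↑))

-- Applied to flip N this also covers relations into W, whose singleton closures are w↑↓.
≡ᴿ-rel0-up-down : {A W U : Set} (N : W → U → Set) (R : A → U → Set) →
  (∀ a → StableU N (rel1 R ｛ a ｝)) → R ≡ᴿ (λ a u → rel0 R (up N (down N ｛ u ｝)) a)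
≡ᴿ-rel0-up-down N R R-stable a u =
    (λ r u′ u′∈u↓↑ → Polarity.down-up-least (flip N) (R-stable a) (λ { refl _ refl → r }) u′∈u↓↑ a refl)
  , (λ r → r u (Polarity.⊆-down-up (flip N) refl))

∀Σ≐rel0 : {A B : Set} (R : A → B → Set) (P : Pred B 0ℓ) →
  (λ a → ∀ (b : Σ B P) → R a (proj₁ b)) ≐ rel0 R P
∀Σ≐rel0 R P = (λ a∈⋂ b b∈P → a∈⋂ (b , b∈P)) , (λ a∈⋂ (b , b∈P) → a∈⋂ b b∈P)

module ConceptLattice {L : Signature} (F : Frame L) where
  open Polarity (N F)

  N-ext-int : (a : Concept F) {w : W F} {u : U F} → ext a w → int a u → N F w u
  N-ext-int a w∈a = proj₁ (ext-down a) w∈a _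

  ext-stable : (a : Concept F) → StableW (N F) (ext a)
  ext-stable a = ≐-trans (ext-down a) ((λ a↑↓ u a↑ → a↑↓ u (proj₂ (int-up a) a↑))
                                      , (λ a↑↓ u a↑ → a↑↓ u (proj₁ (int-up a) a↑)))

  int-stable : (a : Concept F) → StableU (N F) (int a)
  int-stable a = ≐-trans (int-up a) ((λ a↓↑ w a↓ → a↓↑ w (proj₂ (ext-down a) a↓))
                                    , (λ a↓↑ w a↓ → a↓↑ w (proj₁ (ext-down a) a↓)))

  ext-⋀ : {I : Set} (b : I → Concept F) → ext (⋀ F b) ≐ (λ w → ∀ i → ext (b i) w)
  ext-⋀ b = (λ w↑↓ i → down-up-least (ext-stable (b i)) (λ w∈⋂ → w∈⋂ i) w↑↓)
          , ⊆-down-up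

  int-⋁ : {I : Set} (b : I → Concept F) → int (⋁ F b) ≐ (λ u → ∀ i → int (b i) u)
  int-⋁ b = (λ u↓↑ i → Polarity.down-up-least (flip (N F)) (int-stable (b i)) (λ u∈⋂ → u∈⋂ i) u↓↑)
          , Polarity.⊆-down-up (flip (N F))

  int-generators : (a : Concept F) → Σ (U F) (int a) → Concept F
  int-generators a = mkInt F ∘ ｛_｝ ∘ proj₁

  ext-generators : (a : Concept F) → Σ (W F) (ext a) → Concept F
  ext-generators a = mkExt F ∘ ｛_｝ ∘ proj₁

  ≈-⋀-int-generators : (a : Concept F) → _≈_ F a (⋀ F (int-generators a))
  ≈-⋀-int-generators a =
      ( (λ w∈a _ u∈⋂↑ → u∈⋂↑ _ (λ { (_ , v∈a) _ refl → N-ext-int a w∈a v∈a }))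
      , (λ w∈⋂↑↓ → proj₂ (ext-down a) (λ u u∈a → w∈⋂↑↓ u (λ _ w∈⋂ → w∈⋂ (u , u∈a) u refl))) )
    , ( (λ {u} u∈a _ w∈⋂ → w∈⋂ (u , u∈a) u refl)
      , (λ u∈⋂↑ → proj₂ (int-up a) (λ w w∈a → u∈⋂↑ w (λ { (_ , v∈a) _ refl → N-ext-int a w∈a v∈a }))) )

  ≈-⋁-ext-generators : (a : Concept F) → _≈_ F a (⋁ F (ext-generators a))
  ≈-⋁-ext-generators a =
      ( (λ {w} w∈a _ u∈⋂ → u∈⋂ (w , w∈a) w refl)
      , (λ w∈⋂↓ → proj₂ (ext-down a) (λ u u∈a → w∈⋂↓ u (λ { (_ , v∈a) _ refl → N-ext-int a v∈a u∈a }))) )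
    , ( (λ u∈a _ w∈⋂↓ → w∈⋂↓ _ (λ { (_ , v∈a) _ refl → N-ext-int a v∈a u∈a }))
      , (λ u∈⋂↓↑ → proj₂ (int-up a) (λ w w∈a → u∈⋂↓↑ w (λ _ u∈⋂ → u∈⋂ (w , w∈a) w refl))) )

module CompleteHom {L : Signature} (F₁ F₂ : Frame L)
                   (h : Concept F₁ → Concept F₂) (h-hom : IsCompleteHom F₁ F₂ h) where
  open IsCompleteHom h-hom
  open ConceptLattice

  private
    h⁺ : Concept F₁ → PreConcept F₂
    h⁺ a = toPre F₂ (h a)

  ext-h≐rel0-Sh : (a : Concept F₁) → ext (h a) ≐ rel0 (Sh F₁ F₂ h⁺) (int a)
  ext-h≐rel0-Sh a =
    ≐-trans (proj₁ (cong _ _ (≈-⋀-int-generators F₁ a)))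
      (≐-trans (proj₁ (pres-⋀ _ _))
        (≐-trans (ext-⋀ F₂ (h ∘ int-generators F₁ a))
          (∀Σ≐rel0 (Sh F₁ F₂ h⁺) (int a))))

  int-h≐rel0-Th : (a : Concept F₁) → int (h a) ≐ rel0 (Th F₁ F₂ h⁺) (ext a)
  int-h≐rel0-Th a =
    ≐-trans (proj₂ (cong _ _ (≈-⋁-ext-generators F₁ a)))
      (≐-trans (proj₂ (pres-⋁ _ _))
        (≐-trans (int-⋁ F₂ (h ∘ ext-generators F₁ a))
          (∀Σ≐rel0 (Th F₁ F₂ h⁺) (ext a))))

mainTheorem10 : {L : Signature} (F₁ F₂ : Frame L) →
    ((S : W F₁ → U F₂ → Set) (T : U F₁ → W F₂ → Set) → IsPMorphism F₁ F₂ S T →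
      (S ≡ᴿ Sh F₂ F₁ (hST F₁ F₂ S T)) × (T ≡ᴿ Th F₂ F₁ (hST F₁ F₂ S T)))
    × ((h : Concept F₁ → Concept F₂) → IsCompleteHom F₁ F₂ h →
      (a : Concept F₁) →
        (ext (h a) ≐ proj₁ (hST F₂ F₁ (Sh F₁ F₂ (λ x → toPre F₂ (h x))) (Th F₁ F₂ (λ x → toPre F₂ (h x))) a))
        × (int (h a) ≐ proj₂ (hST F₂ F₁ (Sh F₁ F₂ (λ x → toPre F₂ (h x))) (Th F₁ F₂ (λ x → toPre F₂ (h x))) a)))
mainTheorem10 F₁ F₂ =
    (λ S T p-mor → let open IsPMorphism p-mor in
         ≡ᴿ-rel0-up-down (N F₂) S stS1
       , ≡ᴿ-rel0-up-down (flip (N F₂)) T stT1)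
  , (λ h h-hom a → CompleteHom.ext-h≐rel0-Sh F₁ F₂ h h-hom a
                 , CompleteHom.int-h≐rel0-Th F₁ F₂ h h-hom a)
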